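{- Let $n\ge1$, $0\le k\le n$, $m\ge1$, and $g_m^{(k)}(x)=\frac1{2^n}\sum_{\varepsilon\in\{\pm1\}^n}h_m^{(k)}(\varepsilon_1x_1,\dots,\varepsilon_nx_n)$. Then $$g_m^{(k)}(x)=\sum_A\frac{(A\mathbf 1)!}{A!}x^{\vec eA},$$ where the sum runs over all $(k+1)\times n$ upper quadrilateral matrices $A$ with nonnegative integer entries summing to $m$ and all of whose column sums are even.
   Context: $H_m^{(j)}(t_1,\dots,t_j)=\sum_{m_1+\cdots+m_j=m,\ m_i\ge0}t_1^{m_1}\cdots t_j^{m_j}$, and $h_m^{(k)}(x)=H_m^{(k+1)}(s_1,\dots,s_{k+1})$ with $s_i=x_i+\cdots+x_n$ ($1\le i\le n$), $s_{n+1}=0$. A matrix $A=(a_{ij})$ is upper quadrilateral if $a_{ij}=0$ whenever $i>j$. For a matrix (or vector) $M$ of nonnegative integers, $M!$ is the product of the factorials of its entries. $\mathbf 1$ is the all-ones column vector of length $n$, $\vec e$ the all-ones row vector of length $k+1$, and $x^{\vec v}=x_1^{v_1}\cdots x_n^{v_n}$. -}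

module Defs where

open import Data.Nat as ℕ using (ℕ; zero; suc; _≤_; _<_; _≤ᵇ_; _!; NonZero)
open import Data.Nat.Properties as ℕP using (_!≢0; m*n≢0; _<?_; _≟_)
open import Data.Nat.Divisibility using (_∣_; _∣?_)
open import Data.Fin using (Fin; toℕ)
open import Data.Fin.Properties using (all?)
open import Data.Vec as Vec using (Vec; []; _∷_; lookup)
open import Data.List as List using (List; []; _∷_; map; concatMap; upTo; filter; allFin)
open import Data.Rational as ℚ using (ℚ; 0ℚ; 1ℚ; _+_; _*_; -_; _/_; ½)
open import Data.Integer using (+_)
open import Data.Bool using (if_then_else_)
open import Data.Product using (_×_)
open import Relation.Nullary.Decidable using (Dec; _×-dec_; _→-dec_)
open import Relation.Binary.PropositionalEquality using (_≡_)

vecsOver : ∀ {a} {A : Set a} → List A → (n : ℕ) → List (Vec A n)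
vecsOver xs zero    = [] ∷ []
vecsOver xs (suc n) = concatMap (λ x → map (x ∷_) (vecsOver xs n)) xs

sumℚ : List ℚ → ℚ
sumℚ = List.foldr _+_ 0ℚ

prodℚ : List ℚ → ℚ
prodℚ = List.foldr _*_ 1ℚ

powℚ : ℚ → ℕ → ℚ
powℚ t zero    = 1ℚ
powℚ t (suc e) = t * powℚ t e

ΣQ : (n : ℕ) → (Fin n → ℚ) → ℚ
ΣQ n f = sumℚ (map f (allFin n))

ΠQ : (n : ℕ) → (Fin n → ℚ) → ℚ
ΠQ n f = prodℚ (map f (allFin n))

ΣN : (n : ℕ) → (Fin n → ℕ) → ℕ
ΣN n f = List.foldr ℕ._+_ 0 (map f (allFin n))

factProd : List ℕ → ℕ
factProd []       = 1
factProd (a ∷ as) = a ! ℕ.* factProd as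

factProd≢0 : ∀ as → NonZero (factProd as)
factProd≢0 []       = _
factProd≢0 (a ∷ as) = m*n≢0 (a !) (factProd as) {{a !≢0}} {{factProd≢0 as}}

compositions : (j m : ℕ) → List (Vec ℕ j)
compositions j m = filter (λ v → Vec.sum v ≟ m) (vecsOver (upTo (suc m)) j)

H : (j m : ℕ) → (Fin j → ℚ) → ℚ
H j m t = sumℚ (map (λ v → ΠQ j (λ i → powℚ (t i) (lookup v i))) (compositions j m))

-- s_i = x_i + ⋯ + x_n  (paper's 1-based i; here 0-based index i, so
-- s n x i = Σ_{l ≥ i} x_l, and s n x n = 0 = s_{n+1})
s : (n : ℕ) → (Fin n → ℚ) → ℕ → ℚ
s n x i = ΣQ n (λ l → if i ≤ᵇ toℕ l then x l else 0ℚ)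

h : (n k m : ℕ) → (Fin n → ℚ) → ℚ
h n k m x = H (suc k) m (λ i → s n x (toℕ i))

signs : (n : ℕ) → List (Vec ℚ n)
signs n = vecsOver (1ℚ ∷ (- 1ℚ) ∷ []) n

g : (n k m : ℕ) → (Fin n → ℚ) → ℚ
g n k m x = powℚ ½ n * sumℚ (map (λ ε → h n k m (λ l → lookup ε l * x l)) (signs n))

Mat : ℕ → ℕ → Set
Mat r n = Vec (Vec ℕ n) r

entry : ∀ {r n} → Mat r n → Fin r → Fin n → ℕ
entry A i j = lookup (lookup A i) j

rowSum : ∀ {r n} → Mat r n → Fin r → ℕ
rowSum {n = n} A i = ΣN n (λ j → entry A i j)

colSum : ∀ {r n} → Mat r n → Fin n → ℕ
colSum {r = r} A j = ΣN r (λ i → entry A i j)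

entrySum : ∀ {r n} → Mat r n → ℕ
entrySum {r = r} A = ΣN r (rowSum A)

UpperQuad : ∀ {r n} → Mat r n → Set
UpperQuad A = ∀ i j → toℕ j < toℕ i → entry A i j ≡ 0

Admissible : ∀ {r n} → ℕ → Mat r n → Set
Admissible m A = UpperQuad A × (entrySum A ≡ m) × (∀ j → 2 ∣ colSum A j)

admissible? : ∀ {r n} (m : ℕ) (A : Mat r n) → Dec (Admissible m A)
admissible? m A =
  all? (λ i → all? (λ j → (toℕ j <? toℕ i) →-dec (entry A i j ≟ 0)))
  ×-dec (entrySum A ≟ m)
  ×-dec all? (λ j → 2 ∣? colSum A j)

-- all r × n matrices with entries in 0..m, then filtered (entries of an
-- admissible matrix are ≤ m since they sum to m)
admissibleMats : (r n m : ℕ) → List (Mat r n)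
admissibleMats r n m = filter (admissible? m) (vecsOver (vecsOver (upTo (suc m)) n) r)

-- A! = Π_{i,j} a_{ij}!   and   (A 1)! = Π_i (Σ_j a_{ij})!
matFact : ∀ {r n} → Mat r n → List ℕ
matFact {r} {n} A = concatMap (λ i → map (entry A i) (allFin n)) (allFin r)

rowSumsList : ∀ {r n} → Mat r n → List ℕ
rowSumsList {r} A = map (rowSum A) (allFin r)

coeff : ∀ {r n} → Mat r n → ℚ
coeff A = ((+ factProd (rowSumsList A)) / factProd (matFact A)) {{factProd≢0 (matFact A)}}

-- x^{e A} = Π_j x_j^{(column sum j)}
monoEA : ∀ {r n} → (Fin n → ℚ) → Mat r n → ℚ
monoEA {n = n} x A = ΠQ n (λ j → powℚ (x j) (colSum A j))

module Submission where

-- Write s_i = Σ_l z_{il} with z_{il} = [i ≤ l] x_l.  Then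
--   h_m^{(k)}(x) = Σ_{c_0+⋯+c_k = m} Π_i s_i^{c_i}
-- and expanding every power s_i^{c_i} by the multinomial theorem turns the
-- choice of c together with one multinomial term per row into a single
-- (k+1) × n matrix A of exponents: c is recovered as the vector of row sums,
-- the row i contributes the multinomial coefficient (A 1)_i! / Π_l a_{il}!, and
-- the restriction l ≥ i in s_i makes the term vanish unless A is upper
-- quadrilateral.  The monomial of A is Π_l x_l^{(e A)_l}, so after substituting
-- ε_l x_l the sign average factorises over the columns, and each factor
-- ½ (x^c + (-x)^c) = [2 ∣ c] x^c keeps exactly the even column sums.

open import Defs
open import Level using (0ℓ)
open import Data.Nat as ℕ using (ℕ; zero; suc; _≤_; _<_; _≤ᵇ_; _!; NonZero; z≤n; s≤s; _∸_)
import Data.Nat.Properties as NP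
open import Data.Nat.Properties using (_≟_; _≤?_; _<?_)
open import Data.Nat.Combinatorics using (_C_; k![n∸k]!∣n!)
open import Data.Nat.Combinatorics.Specification using (nCk≡n!/k![n-k]!; k>n⇒nCk≡0)
import Data.Nat.DivMod as DM
open import Data.Nat.Divisibility using (_∣_; _∣?_; _∣0; ∣1⇒≡1; ∣m∣n⇒∣m+n; ∣m+n∣m⇒∣n; n∣n)
open import Data.Fin using (Fin; toℕ) renaming (zero to fz; suc to fs)
open import Data.Fin.Properties using (all?; ¬∀⟶∃¬)
open import Data.Vec as Vec using (Vec; []; _∷_; lookup)
open import Data.List as List using (List; []; _∷_; map; concatMap; upTo; filter; allFin; _++_; applyUpTo; _∷ʳ_)
open import Data.Nat.ListAction using (product)
import Data.List.Properties as LP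
open import Data.Rational using (ℚ; 0ℚ; 1ℚ; _+_; _*_; -_; _/_; ½; toℚᵘ; fromℚᵘ)
open import Data.Rational.Properties
  using ( +-identityˡ; +-identityʳ; +-assoc; +-inverseʳ; *-identityˡ; *-assoc
        ; *-zeroˡ; *-zeroʳ; *-distribˡ-+; *-distribʳ-+; neg-distribˡ-*
        ; +-*-commutativeRing
        ; toℚᵘ-homo-+; fromℚᵘ-cong; fromℚᵘ-toℚᵘ )
import Data.Rational.Unnormalised as ℚᵘ
import Data.Rational.Unnormalised.Properties as ℚᵘP
import Data.Integer as ℤ
import Data.Integer.Properties as ℤP
open import Data.Bool using (true; false; T; if_then_else_)
open import Data.Unit using (tt)
open import Data.Empty using (⊥-elim)
open import Data.Sum using (_⊎_; inj₁; inj₂)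
open import Data.Product using (_×_; _,_)
open import Relation.Nullary using (Dec; yes; no; ¬_; contradiction)
open import Relation.Nullary.Decidable using (_×-dec_; _→-dec_)
open import Relation.Binary.PropositionalEquality
open import Function using (_∘_; id)
open import Algebra.Bundles using (CommutativeRing)
import Algebra.Properties.CommutativeSemigroup as CommSemigroupProps
import Algebra.Properties.CommutativeSemiring.Binomial as BinomialProps
import Algebra.Properties.Semiring.Exp as ExpProps
import Algebra.Properties.Semiring.Mult as MultProps
import Algebra.Properties.Monoid.Sum as MonoidSumProps
open import Tactic.RingSolver using (solve-∀)
import Data.Nat.Tactic.RingSolver as ℕ-Solver
open import Tactic.RingSolver.Core.AlmostCommutativeRing using (AlmostCommutativeRing; fromCommutativeRing)
open import Data.Maybe using (nothing)
open ≡-Reasoning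

private
  module ℚ-Ring = CommutativeRing +-*-commutativeRing
  module Exp = ExpProps ℚ-Ring.semiring
  module Mult = MultProps ℚ-Ring.semiring
  module Binomial = BinomialProps ℚ-Ring.commutativeSemiring
  module VecSum = MonoidSumProps ℚ-Ring.+-monoid

ℚ-almostRing : AlmostCommutativeRing 0ℓ 0ℓ
ℚ-almostRing = fromCommutativeRing +-*-commutativeRing (λ _ → nothing)

+-interchange : ∀ a b c d → (a + b) + (c + d) ≡ (a + c) + (b + d)
+-interchange = CommSemigroupProps.interchange ℚ-Ring.+-commutativeSemigroup

*-interchange : ∀ a b c d → (a * b) * (c * d) ≡ (a * c) * (b * d)
*-interchange = CommSemigroupProps.interchange ℚ-Ring.*-commutativeSemigroup

ind : ∀ {p} {P : Set p} → Dec P → ℚ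
ind (yes _) = 1ℚ
ind (no _)  = 0ℚ

ind-× : ∀ {A B : Set} (a : Dec A) (b : Dec B) → ind (a ×-dec b) ≡ ind a * ind b
ind-× (yes _) (yes _) = sym (*-identityˡ 1ℚ)
ind-× (yes _) (no _)  = sym (*-identityˡ 0ℚ)
ind-× (no _)  (yes _) = sym (*-zeroˡ 1ℚ)
ind-× (no _)  (no _)  = sym (*-zeroˡ 0ℚ)

under-indicator : ∀ {A : Set} {x y : ℚ} (d : Dec A) → (A → x ≡ y) → ind d * x ≡ ind d * y
under-indicator (yes a) x≡y = cong (1ℚ *_) (x≡y a)
under-indicator {x = x} {y} (no _) _ = trans (*-zeroˡ x) (sym (*-zeroˡ y))

sum-++ : ∀ {A : Set} (f : A → ℚ) xs ys →
  sumℚ (map f (xs ++ ys)) ≡ sumℚ (map f xs) + sumℚ (map f ys)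
sum-++ f []       ys = sym (+-identityˡ _)
sum-++ f (x ∷ xs) ys = trans (cong (f x +_) (sum-++ f xs ys)) (sym (+-assoc (f x) _ _))

sum-cong : ∀ {A : Set} {f g : A → ℚ} → (∀ x → f x ≡ g x) → ∀ xs →
  sumℚ (map f xs) ≡ sumℚ (map g xs)
sum-cong e []       = refl
sum-cong e (x ∷ xs) = cong₂ _+_ (e x) (sum-cong e xs)

sum-map : ∀ {A B : Set} (f : B → ℚ) (g : A → B) xs →
  sumℚ (map f (map g xs)) ≡ sumℚ (map (f ∘ g) xs)
sum-map f g xs = cong sumℚ (sym (LP.map-∘ xs))

sum-concatMap : ∀ {A B : Set} (f : B → ℚ) (g : A → List B) xs →
  sumℚ (map f (concatMap g xs)) ≡ sumℚ (map (λ x → sumℚ (map f (g x))) xs)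
sum-concatMap f g []       = refl
sum-concatMap f g (x ∷ xs) =
  trans (sum-++ f (g x) (concatMap g xs)) (cong (sumℚ (map f (g x)) +_) (sum-concatMap f g xs))

sum-vecsOver : ∀ {A : Set} (L : List A) n (f : Vec A (suc n) → ℚ) →
  sumℚ (map f (vecsOver L (suc n)))
    ≡ sumℚ (map (λ a → sumℚ (map (λ v → f (a ∷ v)) (vecsOver L n))) L)
sum-vecsOver L n f = trans (sum-concatMap f _ L) (sum-cong (λ a → sum-map f (a ∷_) (vecsOver L n)) L)

sum-distribˡ : ∀ {A : Set} (c : ℚ) (f : A → ℚ) xs →
  c * sumℚ (map f xs) ≡ sumℚ (map (λ x → c * f x) xs)
sum-distribˡ c f []       = *-zeroʳ c
sum-distribˡ c f (x ∷ xs) = trans (*-distribˡ-+ c (f x) _) (cong (c * f x +_) (sum-distribˡ c f xs))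

sum-distribʳ : ∀ {A : Set} (c : ℚ) (f : A → ℚ) xs →
  sumℚ (map f xs) * c ≡ sumℚ (map (λ x → f x * c) xs)
sum-distribʳ c f []       = *-zeroˡ c
sum-distribʳ c f (x ∷ xs) = trans (*-distribʳ-+ c (f x) _) (cong (f x * c +_) (sum-distribʳ c f xs))

sum-zero : ∀ {A : Set} (xs : List A) → sumℚ (map (λ _ → 0ℚ) xs) ≡ 0ℚ
sum-zero []       = refl
sum-zero (x ∷ xs) = trans (+-identityˡ _) (sum-zero xs)

sum-+ : ∀ {A : Set} (f g : A → ℚ) xs →
  sumℚ (map (λ x → f x + g x) xs) ≡ sumℚ (map f xs) + sumℚ (map g xs)
sum-+ f g []       = sym (+-identityˡ _)
sum-+ f g (x ∷ xs) = trans (cong (f x + g x +_) (sum-+ f g xs)) (+-interchange (f x) (g x) _ _)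

sum-swap : ∀ {A B : Set} (f : A → B → ℚ) xs ys →
  sumℚ (map (λ x → sumℚ (map (f x) ys)) xs) ≡ sumℚ (map (λ y → sumℚ (map (λ x → f x y) xs)) ys)
sum-swap f []       ys = sym (sum-zero ys)
sum-swap f (x ∷ xs) ys = trans (cong (sumℚ (map (f x) ys) +_) (sum-swap f xs ys))
  (sym (sum-+ (f x) (λ y → sumℚ (map (λ x → f x y) xs)) ys))

sum-filter : ∀ {A : Set} {P : A → Set} (P? : ∀ x → Dec (P x)) (f : A → ℚ) xs →
  sumℚ (map f (filter P? xs)) ≡ sumℚ (map (λ x → ind (P? x) * f x) xs)
sum-filter P? f [] = refl
sum-filter P? f (x ∷ xs) with P? x
... | yes _ = cong₂ _+_ (sym (*-identityˡ (f x))) (sum-filter P? f xs)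
... | no _  = trans (sum-filter P? f xs) (sym (trans (cong (_+ _) (*-zeroˡ (f x))) (+-identityˡ _)))

map-allFin-suc : ∀ {A : Set} n (f : Fin (suc n) → A) →
  map f (allFin (suc n)) ≡ f fz ∷ map (f ∘ fs) (allFin n)
map-allFin-suc n f = cong (f fz ∷_) (trans (LP.map-tabulate fs f) (sym (LP.map-tabulate id (f ∘ fs))))

ΣQ-suc : ∀ n (f : Fin (suc n) → ℚ) → ΣQ (suc n) f ≡ f fz + ΣQ n (f ∘ fs)
ΣQ-suc n f = cong sumℚ (map-allFin-suc n f)

ΠQ-suc : ∀ n (f : Fin (suc n) → ℚ) → ΠQ (suc n) f ≡ f fz * ΠQ n (f ∘ fs)
ΠQ-suc n f = cong prodℚ (map-allFin-suc n f)

ΣN-suc : ∀ n (f : Fin (suc n) → ℕ) → ΣN (suc n) f ≡ f fz ℕ.+ ΣN n (f ∘ fs)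
ΣN-suc n f = cong (List.foldr ℕ._+_ 0) (map-allFin-suc n f)

ΣN-≤ : ∀ n (f : Fin n → ℕ) i → f i ≤ ΣN n f
ΣN-≤ (suc n) f fz     = subst (f fz ≤_) (sym (ΣN-suc n f)) (NP.m≤m+n (f fz) _)
ΣN-≤ (suc n) f (fs i) =
  subst (f (fs i) ≤_) (sym (ΣN-suc n f)) (NP.≤-trans (ΣN-≤ n (f ∘ fs) i) (NP.m≤n+m _ (f fz)))

ΠQ-cong : ∀ n {f g : Fin n → ℚ} → (∀ i → f i ≡ g i) → ΠQ n f ≡ ΠQ n g
ΠQ-cong n e = cong prodℚ (LP.map-cong e (allFin n))

ΠQ-* : ∀ n (f g : Fin n → ℚ) → ΠQ n (λ i → f i * g i) ≡ ΠQ n f * ΠQ n g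
ΠQ-* zero    f g = refl
ΠQ-* (suc n) f g = begin
  ΠQ (suc n) (λ i → f i * g i)                       ≡⟨ ΠQ-suc n (λ i → f i * g i) ⟩
  (f fz * g fz) * ΠQ n (λ i → f (fs i) * g (fs i))   ≡⟨ cong (f fz * g fz *_) (ΠQ-* n (f ∘ fs) (g ∘ fs)) ⟩
  (f fz * g fz) * (ΠQ n (f ∘ fs) * ΠQ n (g ∘ fs))    ≡⟨ *-interchange (f fz) (g fz) _ _ ⟩
  (f fz * ΠQ n (f ∘ fs)) * (g fz * ΠQ n (g ∘ fs))    ≡⟨ sym (cong₂ _*_ (ΠQ-suc n f) (ΠQ-suc n g)) ⟩
  ΠQ (suc n) f * ΠQ (suc n) g                        ∎

ΠQ-1 : ∀ n (f : Fin n → ℚ) → (∀ i → f i ≡ 1ℚ) → ΠQ n f ≡ 1ℚ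
ΠQ-1 zero    f e = refl
ΠQ-1 (suc n) f e =
  trans (ΠQ-suc n f) (trans (cong₂ _*_ (e fz) (ΠQ-1 n (f ∘ fs) (e ∘ fs))) (*-identityˡ 1ℚ))

ΠQ-0 : ∀ n (f : Fin n → ℚ) i → f i ≡ 0ℚ → ΠQ n f ≡ 0ℚ
ΠQ-0 (suc n) f fz     e = trans (ΠQ-suc n f) (trans (cong (_* ΠQ n (f ∘ fs)) e) (*-zeroˡ (ΠQ n (f ∘ fs))))
ΠQ-0 (suc n) f (fs i) e = trans (ΠQ-suc n f) (trans (cong (f fz *_) (ΠQ-0 n (f ∘ fs) i e)) (*-zeroʳ (f fz)))

ind-all : ∀ n {P : Fin n → Set} (P? : ∀ i → Dec (P i)) → ind (all? P?) ≡ ΠQ n (λ i → ind (P? i))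
ind-all n {P} P? with all? P?
... | yes p = sym (ΠQ-1 n _ one)
  where
  one : ∀ i → ind (P? i) ≡ 1ℚ
  one i with P? i
  ... | yes _ = refl
  ... | no ¬q = ⊥-elim (¬q (p i))
... | no ¬p with ¬∀⟶∃¬ n P P? ¬p
... | (i , ¬Pi) = sym (ΠQ-0 n _ i zero-at-i)
  where
  zero-at-i : ind (P? i) ≡ 0ℚ
  zero-at-i with P? i
  ... | yes q = ⊥-elim (¬Pi q)
  ... | no _  = refl

ΠQ-swap : ∀ r n (f : Fin r → Fin n → ℚ) →
  ΠQ r (λ i → ΠQ n (λ j → f i j)) ≡ ΠQ n (λ j → ΠQ r (λ i → f i j))
ΠQ-swap zero    n f = sym (ΠQ-1 n _ (λ _ → refl))
ΠQ-swap (suc r) n f = begin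
  ΠQ (suc r) (λ i → ΠQ n (f i))                       ≡⟨ ΠQ-suc r (λ i → ΠQ n (f i)) ⟩
  ΠQ n (f fz) * ΠQ r (λ i → ΠQ n (f (fs i)))          ≡⟨ cong (ΠQ n (f fz) *_) (ΠQ-swap r n (f ∘ fs)) ⟩
  ΠQ n (f fz) * ΠQ n (λ j → ΠQ r (λ i → f (fs i) j))  ≡⟨ sym (ΠQ-* n (f fz) _) ⟩
  ΠQ n (λ j → f fz j * ΠQ r (λ i → f (fs i) j))      ≡⟨ ΠQ-cong n (λ j → sym (ΠQ-suc r (λ i → f i j))) ⟩
  ΠQ n (λ j → ΠQ (suc r) (λ i → f i j))               ∎

pow-+ : ∀ t a b → powℚ t (a ℕ.+ b) ≡ powℚ t a * powℚ t b
pow-+ t zero    b = sym (*-identityˡ _)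
pow-+ t (suc a) b = trans (cong (t *_) (pow-+ t a b)) (sym (*-assoc t _ _))

ΠQ-pow : ∀ r t (f : Fin r → ℕ) → ΠQ r (λ i → powℚ t (f i)) ≡ powℚ t (ΣN r f)
ΠQ-pow zero    t f = refl
ΠQ-pow (suc r) t f = begin
  ΠQ (suc r) (λ i → powℚ t (f i))                 ≡⟨ ΠQ-suc r (λ i → powℚ t (f i)) ⟩
  powℚ t (f fz) * ΠQ r (λ i → powℚ t (f (fs i)))  ≡⟨ cong (powℚ t (f fz) *_) (ΠQ-pow r t (f ∘ fs)) ⟩
  powℚ t (f fz) * powℚ t (ΣN r (f ∘ fs))          ≡⟨ sym (pow-+ t (f fz) _) ⟩
  powℚ t (f fz ℕ.+ ΣN r (f ∘ fs))                 ≡⟨ cong (powℚ t) (sym (ΣN-suc r f)) ⟩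
  powℚ t (ΣN (suc r) f)                           ∎

pow-as-ΠQ : ∀ t n → powℚ t n ≡ ΠQ n (λ _ → t)
pow-as-ΠQ t zero    = refl
pow-as-ΠQ t (suc n) = trans (cong (t *_) (pow-as-ΠQ t n)) (sym (ΠQ-suc n (λ _ → t)))

ΠQ-of-sums : ∀ {A : Set} (L : List A) r (F : Fin r → A → ℚ) →
  ΠQ r (λ i → sumℚ (map (F i) L)) ≡ sumℚ (map (λ v → ΠQ r (λ i → F i (lookup v i))) (vecsOver L r))
ΠQ-of-sums L zero    F = sym (+-identityʳ 1ℚ)
ΠQ-of-sums L (suc r) F = begin
  ΠQ (suc r) (λ i → sumℚ (map (F i) L))
    ≡⟨ ΠQ-suc r (λ i → sumℚ (map (F i) L)) ⟩
  sumℚ (map (F fz) L) * ΠQ r (λ i → sumℚ (map (F (fs i)) L))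
    ≡⟨ cong (sumℚ (map (F fz) L) *_) (ΠQ-of-sums L r (F ∘ fs)) ⟩
  sumℚ (map (F fz) L) * sumℚ (map tail (vecsOver L r))
    ≡⟨ sum-distribʳ _ (F fz) L ⟩
  sumℚ (map (λ a → F fz a * sumℚ (map tail (vecsOver L r))) L)
    ≡⟨ sum-cong (λ a → sum-distribˡ (F fz a) tail (vecsOver L r)) L ⟩
  sumℚ (map (λ a → sumℚ (map (λ v → F fz a * tail v) (vecsOver L r))) L)
    ≡⟨ sum-cong (λ a → sum-cong (λ v → sym (ΠQ-suc r (λ i → F i (lookup (a ∷ v) i)))) (vecsOver L r)) L ⟩
  sumℚ (map (λ a → sumℚ (map (λ v → ΠQ (suc r) (λ i → F i (lookup (a ∷ v) i))) (vecsOver L r))) L)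
    ≡⟨ sym (sum-vecsOver L r (λ v → ΠQ (suc r) (λ i → F i (lookup v i)))) ⟩
  sumℚ (map (λ v → ΠQ (suc r) (λ i → F i (lookup v i))) (vecsOver L (suc r))) ∎
  where
  tail : Vec _ r → ℚ
  tail v = ΠQ r (λ i → F (fs i) (lookup v i))

ι : ℕ → ℚ
ι n = n Mult.× 1ℚ

ι-* : ∀ a b → ι (a ℕ.* b) ≡ ι a * ι b
ι-* = Mult.×1-homo-*

×-as-* : ∀ n x → n Mult.× x ≡ ι n * x
×-as-* n x = sym (trans (Mult.×-assoc-* n 1ℚ x) (cong (n Mult.×_) (*-identityˡ x)))

^-as-powℚ : ∀ x n → x Exp.^ n ≡ powℚ x n
^-as-powℚ x zero    = refl
^-as-powℚ x (suc n) = cong (x *_) (^-as-powℚ x n)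

vecSum-as-upTo : ∀ N (f : ℕ → ℚ) → VecSum.sum {N} (λ k → f (toℕ k)) ≡ sumℚ (map f (upTo N))
vecSum-as-upTo N f = trans (go N f) (cong sumℚ (sym (LP.map-upTo f N)))
  where
  go : ∀ N (f : ℕ → ℚ) → VecSum.sum {N} (λ k → f (toℕ k)) ≡ sumℚ (applyUpTo f N)
  go zero    f = refl
  go (suc N) f = cong (f 0 +_) (go N (f ∘ suc))

sum-upTo-extend : ∀ (f : ℕ → ℚ) N M → (∀ a → N ≤ a → f a ≡ 0ℚ) → N ≤ M →
  sumℚ (map f (upTo N)) ≡ sumℚ (map f (upTo M))
sum-upTo-extend f N zero    vanish z≤n = refl
sum-upTo-extend f N (suc M) vanish N≤1+M with NP.m≤n⇒m<n∨m≡n N≤1+M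
... | inj₂ refl = refl
... | inj₁ (s≤s N≤M) = begin
  sumℚ (map f (upTo N))                       ≡⟨ sum-upTo-extend f N M vanish N≤M ⟩
  sumℚ (map f (upTo M))                       ≡⟨ sym (+-identityʳ _) ⟩
  sumℚ (map f (upTo M)) + 0ℚ                  ≡⟨ cong (sumℚ (map f (upTo M)) +_) last-vanishes ⟩
  sumℚ (map f (upTo M)) + sumℚ (map f (M ∷ [])) ≡⟨ sym (sum-++ f (upTo M) (M ∷ [])) ⟩
  sumℚ (map f (upTo M ∷ʳ M))                  ≡⟨ cong (λ l → sumℚ (map f l)) (LP.upTo-∷ʳ M) ⟩
  sumℚ (map f (upTo (suc M)))                 ∎
  where
  last-vanishes : 0ℚ ≡ f M + 0ℚ
  last-vanishes = sym (trans (+-identityʳ (f M)) (vanish M N≤M))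

-- The binomial theorem, with the index running over 0, …, M for any M ≥ p
-- (the binomial coefficients vanish beyond p).
binomial : ∀ p M → p ≤ M → ∀ x y →
  powℚ (x + y) p ≡ sumℚ (map (λ a → ι (p C a) * (powℚ x a * powℚ y (p ∸ a))) (upTo (suc M)))
binomial p M p≤M x y = begin
  powℚ (x + y) p                         ≡⟨ sym (^-as-powℚ (x + y) p) ⟩
  (x + y) Exp.^ p                        ≡⟨ Binomial.theorem p x y ⟩
  Binomial.binomialExpansion x y p       ≡⟨ VecSum.sum-cong-≋ {suc p} (λ k → as-term (toℕ k)) ⟩
  VecSum.sum {suc p} (λ k → term (toℕ k)) ≡⟨ vecSum-as-upTo (suc p) term ⟩
  sumℚ (map term (upTo (suc p)))         ≡⟨ sum-upTo-extend term (suc p) (suc M) vanish (s≤s p≤M) ⟩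
  sumℚ (map term (upTo (suc M)))         ∎
  where
  term : ℕ → ℚ
  term a = ι (p C a) * (powℚ x a * powℚ y (p ∸ a))
  as-term : ∀ a → (p C a) Mult.× (x Exp.^ a * y Exp.^ (p ∸ a)) ≡ term a
  as-term a = trans (×-as-* (p C a) _) (cong (ι (p C a) *_) (cong₂ _*_ (^-as-powℚ x a) (^-as-powℚ y (p ∸ a))))
  vanish : ∀ a → suc p ≤ a → term a ≡ 0ℚ
  vanish a p<a = trans (cong (λ c → ι c * monomial) (k>n⇒nCk≡0 p<a)) (*-zeroˡ monomial)
    where monomial = powℚ x a * powℚ y (p ∸ a)

-- Total and multinomial coefficient (Σ v)! / Π_l v_l! of an exponent vector,
-- the latter built from binomial coefficients.
total : ∀ {n} → Vec ℕ n → ℕ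
total {n} v = ΣN n (lookup v)

multinomialCoeff : ∀ {n} → Vec ℕ n → ℕ
multinomialCoeff []      = 1
multinomialCoeff (a ∷ v) = ((a ℕ.+ total v) C a) ℕ.* multinomialCoeff v

multinomialTerm : ∀ {n} → ℕ → (Fin n → ℚ) → Vec ℕ n → ℚ
multinomialTerm {n} p z v =
  ind (total v ≟ p) * (ι (multinomialCoeff v) * ΠQ n (λ l → powℚ (z l) (lookup v l)))

coefficient-cons : ∀ p a r M {s} → s ≡ a ℕ.+ r → (d : Dec (s ≡ p)) (d′ : Dec (r ≡ p ∸ a)) →
  ind d * ι (((a ℕ.+ r) C a) ℕ.* M) ≡ ι (p C a) * (ind d′ * ι M)
coefficient-cons _ a r M refl (yes refl) (yes _) =
  trans (*-identityˡ (ι (K ℕ.* M))) (trans (ι-* K M) (cong (ι K *_) (sym (*-identityˡ (ι M)))))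
  where K = (a ℕ.+ r) C a
coefficient-cons _ a r M refl (yes refl) (no r≢) = contradiction (sym (NP.m+n∸m≡n a r)) r≢
coefficient-cons p a r M refl (no a+r≢p) (yes refl) with a ≤? p
... | yes a≤p = contradiction (NP.m+[n∸m]≡n a≤p) a+r≢p
... | no a≰p  = begin
  0ℚ * ι (((a ℕ.+ (p ∸ a)) C a) ℕ.* M) ≡⟨ *-zeroˡ (ι (((a ℕ.+ (p ∸ a)) C a) ℕ.* M)) ⟩
  0ℚ                                    ≡⟨ sym (*-zeroˡ (1ℚ * ι M)) ⟩
  0ℚ * (1ℚ * ι M)                       ≡⟨ cong (λ c → ι c * (1ℚ * ι M)) (sym (k>n⇒nCk≡0 (NP.≰⇒> a≰p))) ⟩
  ι (p C a) * (1ℚ * ι M)                ∎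
coefficient-cons p a r M refl (no _) (no _) =
  trans (*-zeroˡ (ι (((a ℕ.+ r) C a) ℕ.* M))) (sym (trans (cong (ι (p C a) *_) (*-zeroˡ (ι M))) (*-zeroʳ (ι (p C a)))))

rearrange-cons : ∀ P D M X Q → (P * (D * M)) * (X * Q) ≡ P * (X * (D * (M * Q)))
rearrange-cons = solve-∀ ℚ-almostRing

multinomialTerm-cons : ∀ {n} p (z : Fin (suc n) → ℚ) a (v : Vec ℕ n) →
  multinomialTerm p z (a ∷ v) ≡ ι (p C a) * (powℚ (z fz) a * multinomialTerm (p ∸ a) (z ∘ fs) v)
multinomialTerm-cons {n} p z a v = begin
  ind d * (ι (multinomialCoeff (a ∷ v)) * ΠQ (suc n) (λ l → powℚ (z l) (lookup (a ∷ v) l)))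
    ≡⟨ cong (λ t → ind d * (ι (multinomialCoeff (a ∷ v)) * t)) (ΠQ-suc n (λ l → powℚ (z l) (lookup (a ∷ v) l))) ⟩
  ind d * (ι (multinomialCoeff (a ∷ v)) * (X * Q))
    ≡⟨ sym (*-assoc (ind d) _ (X * Q)) ⟩
  (ind d * ι (multinomialCoeff (a ∷ v))) * (X * Q)
    ≡⟨ cong (_* (X * Q)) (coefficient-cons p a (total v) (multinomialCoeff v) (ΣN-suc n (lookup (a ∷ v))) d d′) ⟩
  (ι (p C a) * (ind d′ * ι (multinomialCoeff v))) * (X * Q)
    ≡⟨ rearrange-cons (ι (p C a)) (ind d′) (ι (multinomialCoeff v)) X Q ⟩
  ι (p C a) * (X * multinomialTerm (p ∸ a) (z ∘ fs) v) ∎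
  where
  d  = total (a ∷ v) ≟ p
  d′ = total v ≟ p ∸ a
  X  = powℚ (z fz) a
  Q  = ΠQ n (λ l → powℚ (z (fs l)) (lookup v l))

multinomial : ∀ m n p → p ≤ m → ∀ (z : Fin n → ℚ) →
  powℚ (ΣQ n z) p ≡ sumℚ (map (multinomialTerm p z) (vecsOver (upTo (suc m)) n))
multinomial m zero zero    p≤m z = refl
multinomial m zero (suc p) p≤m z = begin
  0ℚ * powℚ 0ℚ p                 ≡⟨ *-zeroˡ (powℚ 0ℚ p) ⟩
  0ℚ                             ≡⟨ sym (trans (+-identityʳ (0ℚ * (ι 1 * 1ℚ))) (*-zeroˡ (ι 1 * 1ℚ))) ⟩
  0ℚ * (ι 1 * 1ℚ) + 0ℚ           ∎
multinomial m (suc n) p p≤m z = begin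
  powℚ (ΣQ (suc n) z) p
    ≡⟨ cong (λ t → powℚ t p) (ΣQ-suc n z) ⟩
  powℚ (z fz + ΣQ n (z ∘ fs)) p
    ≡⟨ binomial p m p≤m (z fz) (ΣQ n (z ∘ fs)) ⟩
  sumℚ (map (λ a → ι (p C a) * (powℚ (z fz) a * powℚ (ΣQ n (z ∘ fs)) (p ∸ a))) B)
    ≡⟨ sum-cong (λ a → cong (λ t → ι (p C a) * (powℚ (z fz) a * t)) (rest a)) B ⟩
  sumℚ (map (λ a → ι (p C a) * (powℚ (z fz) a * sumℚ (map (multinomialTerm (p ∸ a) (z ∘ fs)) V))) B)
    ≡⟨ sum-cong (λ a → trans (cong (ι (p C a) *_) (sum-distribˡ (powℚ (z fz) a) _ V)) (sum-distribˡ (ι (p C a)) _ V)) B ⟩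
  sumℚ (map (λ a → sumℚ (map (λ v → ι (p C a) * (powℚ (z fz) a * multinomialTerm (p ∸ a) (z ∘ fs) v)) V)) B)
    ≡⟨ sum-cong (λ a → sum-cong (λ v → sym (multinomialTerm-cons p z a v)) V) B ⟩
  sumℚ (map (λ a → sumℚ (map (λ v → multinomialTerm p z (a ∷ v)) V)) B)
    ≡⟨ sym (sum-vecsOver B n (multinomialTerm p z)) ⟩
  sumℚ (map (multinomialTerm p z) (vecsOver B (suc n))) ∎
  where
  B = upTo (suc m)
  V = vecsOver B n
  rest : ∀ a → powℚ (ΣQ n (z ∘ fs)) (p ∸ a) ≡ sumℚ (map (multinomialTerm (p ∸ a) (z ∘ fs)) V)
  rest a = multinomial m n (p ∸ a) (NP.≤-trans (NP.m∸n≤m p a) p≤m) (z ∘ fs)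

factProd-++ : ∀ xs ys → factProd (xs ++ ys) ≡ factProd xs ℕ.* factProd ys
factProd-++ []       ys = sym (NP.+-identityʳ _)
factProd-++ (x ∷ xs) ys = trans (cong (x ! ℕ.*_) (factProd-++ xs ys)) (sym (NP.*-assoc (x !) _ _))

factProd-concatMap : ∀ {A : Set} (f : A → List ℕ) xs →
  factProd (concatMap f xs) ≡ product (map (factProd ∘ f) xs)
factProd-concatMap f []       = refl
factProd-concatMap f (x ∷ xs) =
  trans (factProd-++ (f x) (concatMap f xs)) (cong (factProd (f x) ℕ.*_) (factProd-concatMap f xs))

factProd-map : ∀ {A : Set} (f : A → ℕ) xs → factProd (map f xs) ≡ product (map (λ x → f x !) xs)
factProd-map f []       = refl
factProd-map f (x ∷ xs) = cong (f x ! ℕ.*_) (factProd-map f xs)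

product-* : ∀ {A : Set} (f g : A → ℕ) xs →
  product (map (λ x → f x ℕ.* g x) xs) ≡ product (map f xs) ℕ.* product (map g xs)
product-* f g []       = refl
product-* f g (x ∷ xs) =
  trans (cong (f x ℕ.* g x ℕ.*_) (product-* f g xs))
        (CommSemigroupProps.interchange NP.*-commutativeSemigroup (f x) (g x) _ _)

binomial-factorials : ∀ {k n} → k ≤ n → (n C k) ℕ.* (k ! ℕ.* (n ∸ k) !) ≡ n !
binomial-factorials {k} {n} k≤n = begin
  (n C k) ℕ.* D                 ≡⟨ cong (ℕ._* D) (nCk≡n!/k![n-k]! k≤n) ⟩
  ((n ! DM./ D) {{D≢0}}) ℕ.* D  ≡⟨ DM.m/n*n≡m {{D≢0}} (k![n∸k]!∣n! k≤n) ⟩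
  n !                           ∎
  where
  D = k ! ℕ.* (n ∸ k) !
  D≢0 : NonZero D
  D≢0 = NP.m*n≢0 (k !) ((n ∸ k) !) {{k NP.!≢0}} {{(n ∸ k) NP.!≢0}}

multinomialCoeff-factorials : ∀ {n} (v : Vec ℕ n) →
  multinomialCoeff v ℕ.* factProd (map (lookup v) (allFin n)) ≡ (total v) !
multinomialCoeff-factorials [] = refl
multinomialCoeff-factorials {suc n} (a ∷ v) = begin
  (K ℕ.* multinomialCoeff v) ℕ.* factProd (map (lookup (a ∷ v)) (allFin (suc n)))
    ≡⟨ cong (λ l → (K ℕ.* multinomialCoeff v) ℕ.* factProd l) (map-allFin-suc n (lookup (a ∷ v))) ⟩
  (K ℕ.* multinomialCoeff v) ℕ.* (a ! ℕ.* F)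
    ≡⟨ rearrange K (multinomialCoeff v) (a !) F ⟩
  K ℕ.* (a ! ℕ.* (multinomialCoeff v ℕ.* F))
    ≡⟨ cong (λ t → K ℕ.* (a ! ℕ.* t)) (multinomialCoeff-factorials v) ⟩
  K ℕ.* (a ! ℕ.* (total v) !)
    ≡⟨ cong (λ t → K ℕ.* (a ! ℕ.* t !)) (sym (NP.m+n∸m≡n a (total v))) ⟩
  K ℕ.* (a ! ℕ.* (a ℕ.+ total v ∸ a) !)
    ≡⟨ binomial-factorials (NP.m≤m+n a (total v)) ⟩
  (a ℕ.+ total v) !
    ≡⟨ cong _! (sym (ΣN-suc n (lookup (a ∷ v)))) ⟩
  (total (a ∷ v)) ! ∎
  where
  K = (a ℕ.+ total v) C a
  F = factProd (map (lookup v) (allFin n))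
  rearrange : ∀ k c x f → k ℕ.* c ℕ.* (x ℕ.* f) ≡ k ℕ.* (x ℕ.* (c ℕ.* f))
  rearrange = ℕ-Solver.solve-∀

ι-as-fraction : ∀ M → toℚᵘ (ι M) ℚᵘ.≃ ℚᵘ.mkℚᵘ (ℤ.+ M) 0
ι-as-fraction zero    = ℚᵘP.≃-refl
ι-as-fraction (suc M) = ℚᵘP.≃-trans (toℚᵘ-homo-+ 1ℚ (ι M))
  (ℚᵘP.≃-trans (ℚᵘP.+-congʳ (toℚᵘ 1ℚ) (ι-as-fraction M))
               (ℚᵘ.*≡* (cong (ℤ._* ℤ.+ 1) (cong (λ t → (ℤ.+ 1) ℤ.+ t) (ℤP.*-identityʳ (ℤ.+ M))))))

cancel-denominator : ∀ M D .{{_ : NonZero D}} → (ℤ.+ (M ℕ.* D)) / D ≡ ι M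
cancel-denominator M (suc d) = begin
  fromℚᵘ scaled                         ≡⟨ fromℚᵘ-cong {scaled} {whole} (ℚᵘ.*≡* cross) ⟩
  fromℚᵘ whole                          ≡⟨ fromℚᵘ-cong (ℚᵘP.≃-sym (ι-as-fraction M)) ⟩
  fromℚᵘ (toℚᵘ (ι M))                   ≡⟨ fromℚᵘ-toℚᵘ (ι M) ⟩
  ι M                                   ∎
  where
  scaled whole : ℚᵘ.ℚᵘ
  scaled = ℚᵘ.mkℚᵘ (ℤ.+ (M ℕ.* suc d)) d
  whole  = ℚᵘ.mkℚᵘ (ℤ.+ M) 0
  cross : ℤ.+ (M ℕ.* suc d) ℤ.* ℤ.+ 1 ≡ ℤ.+ M ℤ.* ℤ.+ (suc d)
  cross = trans (ℤP.*-identityʳ _) (ℤP.pos-* M (suc d))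

ι-product : ∀ {A : Set} (f : A → ℕ) xs → ι (product (map f xs)) ≡ prodℚ (map (ι ∘ f) xs)
ι-product f []       = +-identityʳ 1ℚ
ι-product f (x ∷ xs) = trans (ι-* (f x) _) (cong (ι (f x) *_) (ι-product f xs))

coeff-as-rowMultinomials : ∀ {r n} (A : Mat r n) → coeff A ≡ ΠQ r (λ i → ι (multinomialCoeff (lookup A i)))
coeff-as-rowMultinomials {r} {n} A = begin
  ((ℤ.+ (factProd (rowSumsList A))) / factProd (matFact A)) {{factProd≢0 (matFact A)}}
    ≡⟨ cong (λ t → ((ℤ.+ t) / factProd (matFact A)) {{factProd≢0 (matFact A)}}) numerator ⟩
  ((ℤ.+ (P ℕ.* factProd (matFact A))) / factProd (matFact A)) {{factProd≢0 (matFact A)}}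
    ≡⟨ cancel-denominator P (factProd (matFact A)) {{factProd≢0 (matFact A)}} ⟩
  ι P
    ≡⟨ ι-product (λ i → multinomialCoeff (lookup A i)) (allFin r) ⟩
  ΠQ r (λ i → ι (multinomialCoeff (lookup A i))) ∎
  where
  P = product (map (λ i → multinomialCoeff (lookup A i)) (allFin r))
  numerator : factProd (rowSumsList A) ≡ P ℕ.* factProd (matFact A)
  numerator = begin
    factProd (map (rowSum A) (allFin r))
      ≡⟨ factProd-map (rowSum A) (allFin r) ⟩
    product (map (λ i → rowSum A i !) (allFin r))
      ≡⟨ cong product (LP.map-cong (λ i → sym (multinomialCoeff-factorials (lookup A i))) (allFin r)) ⟩
    product (map (λ i → multinomialCoeff (lookup A i) ℕ.* factProd (map (entry A i) (allFin n))) (allFin r))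
      ≡⟨ product-* (λ i → multinomialCoeff (lookup A i)) (λ i → factProd (map (entry A i) (allFin n))) (allFin r) ⟩
    P ℕ.* product (map (λ i → factProd (map (entry A i) (allFin n))) (allFin r))
      ≡⟨ cong (P ℕ.*_) (sym (factProd-concatMap (λ i → map (entry A i) (allFin n)) (allFin r))) ⟩
    P ℕ.* factProd (matFact A) ∎

lookup≤sum : ∀ {n} (v : Vec ℕ n) i → lookup v i ≤ Vec.sum v
lookup≤sum (a ∷ v) fz     = NP.m≤m+n a (Vec.sum v)
lookup≤sum (a ∷ v) (fs i) = NP.≤-trans (lookup≤sum v i) (NP.m≤n+m (Vec.sum v) a)

sum-tabulate : ∀ n (f : Fin n → ℕ) → Vec.sum (Vec.tabulate f) ≡ ΣN n f
sum-tabulate zero    f = refl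
sum-tabulate (suc n) f = trans (cong (f fz ℕ.+_) (sum-tabulate n (f ∘ fs))) (sym (ΣN-suc n f))

sum-delta : ∀ M r (F : ℕ → ℚ) → sumℚ (map (λ a → ind (r ≟ a) * F a) (upTo M)) ≡ ind (r <? M) * F r
sum-delta zero r F with r <? zero
... | no _ = sym (*-zeroˡ (F r))
sum-delta (suc M) r F = begin
  sumℚ (map δF (upTo (suc M)))              ≡⟨ cong (λ l → sumℚ (map δF l)) (sym (LP.upTo-∷ʳ M)) ⟩
  sumℚ (map δF (upTo M ∷ʳ M))               ≡⟨ sum-++ δF (upTo M) (M ∷ []) ⟩
  sumℚ (map δF (upTo M)) + (δF M + 0ℚ)      ≡⟨ cong₂ _+_ (sum-delta M r F) (+-identityʳ (δF M)) ⟩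
  ind (r <? M) * F r + ind (r ≟ M) * F M    ≡⟨ last-step (r <? M) (r ≟ M) (r <? suc M) ⟩
  ind (r <? suc M) * F r                    ∎
  where
  δF : ℕ → ℚ
  δF a = ind (r ≟ a) * F a
  last-step : (d₁ : Dec (r < M)) (d₂ : Dec (r ≡ M)) (d₃ : Dec (r < suc M)) →
    ind d₁ * F r + ind d₂ * F M ≡ ind d₃ * F r
  last-step (yes r<M) (yes refl) _         = ⊥-elim (NP.<-irrefl refl r<M)
  last-step (yes _)   (no _)     (yes _)   = trans (cong (1ℚ * F r +_) (*-zeroˡ (F M))) (+-identityʳ _)
  last-step (yes r<M) (no _)     (no r≮1+M) = ⊥-elim (r≮1+M (NP.m<n⇒m<1+n r<M))
  last-step (no _)    (yes refl) (yes _)   = trans (cong (_+ 1ℚ * F r) (*-zeroˡ (F r))) (+-identityˡ _)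
  last-step (no _)    (yes refl) (no r≮1+M) = ⊥-elim (r≮1+M (NP.n<1+n r))
  last-step (no r≮M)  (no r≢M)   (yes r<1+M) with NP.m≤n⇒m<n∨m≡n (NP.≤-pred r<1+M)
  ... | inj₁ r<M = ⊥-elim (r≮M r<M)
  ... | inj₂ r≡M = ⊥-elim (r≢M r≡M)
  last-step (no _)    (no _)     (no _)    =
    trans (cong₂ _+_ (*-zeroˡ (F r)) (*-zeroˡ (F M))) (trans (+-identityˡ 0ℚ) (sym (*-zeroˡ (F r))))

sum-deltas : ∀ M N (G : Vec ℕ N → ℚ) (ρ : Fin N → ℕ) →
  sumℚ (map (λ c → G c * ΠQ N (λ i → ind (ρ i ≟ lookup c i))) (vecsOver (upTo M) N))
    ≡ G (Vec.tabulate ρ) * ΠQ N (λ i → ind (ρ i <? M))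
sum-deltas M zero    G ρ = +-identityʳ _
sum-deltas M (suc N) G ρ = begin
  sumℚ (map (λ c → G c * ΠQ (suc N) (δ c)) (vecsOver B (suc N)))
    ≡⟨ sum-vecsOver B N _ ⟩
  sumℚ (map (λ a → sumℚ (map (λ c → G (a ∷ c) * ΠQ (suc N) (δ (a ∷ c))) V)) B)
    ≡⟨ sum-cong (λ a → sum-cong (λ c → trans (cong (G (a ∷ c) *_) (ΠQ-suc N (δ (a ∷ c))))
                                             (swap-front (G (a ∷ c)) (ind (ρ fz ≟ a)) _)) V) B ⟩
  sumℚ (map (λ a → sumℚ (map (λ c → ind (ρ fz ≟ a) * rest a c) V)) B)
    ≡⟨ sum-cong (λ a → sym (sum-distribˡ (ind (ρ fz ≟ a)) (rest a) V)) B ⟩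
  sumℚ (map (λ a → ind (ρ fz ≟ a) * sumℚ (map (rest a) V)) B)
    ≡⟨ sum-cong (λ a → cong (ind (ρ fz ≟ a) *_) (sum-deltas M N (λ c → G (a ∷ c)) (ρ ∘ fs))) B ⟩
  sumℚ (map (λ a → ind (ρ fz ≟ a) * F a) B)
    ≡⟨ sum-delta M (ρ fz) F ⟩
  ind (ρ fz <? M) * F (ρ fz)
    ≡⟨ sym (swap-front (G (Vec.tabulate ρ)) (ind (ρ fz <? M)) _) ⟩
  G (Vec.tabulate ρ) * (ind (ρ fz <? M) * ΠQ N (λ i → ind (ρ (fs i) <? M)))
    ≡⟨ cong (G (Vec.tabulate ρ) *_) (sym (ΠQ-suc N (λ i → ind (ρ i <? M)))) ⟩
  G (Vec.tabulate ρ) * ΠQ (suc N) (λ i → ind (ρ i <? M)) ∎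
  where
  B = upTo M
  V = vecsOver B N
  δ : Vec ℕ (suc N) → Fin (suc N) → ℚ
  δ c i = ind (ρ i ≟ lookup c i)
  rest : ℕ → Vec ℕ N → ℚ
  rest a c = G (a ∷ c) * ΠQ N (λ i → ind (ρ (fs i) ≟ lookup c i))
  F : ℕ → ℚ
  F a = G (a ∷ Vec.tabulate (ρ ∘ fs)) * ΠQ N (λ i → ind (ρ (fs i) <? M))
  swap-front : ∀ x y z → x * (y * z) ≡ y * (x * z)
  swap-front = solve-∀ ℚ-almostRing

sum-condition : ∀ r m (ρ : Fin r → ℕ) →
  ind (Vec.sum (Vec.tabulate ρ) ≟ m) * ΠQ r (λ i → ind (ρ i <? suc m)) ≡ ind (ΣN r ρ ≟ m)
sum-condition r m ρ with Vec.sum (Vec.tabulate ρ) ≟ m | ΣN r ρ ≟ m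
... | yes e | yes _ = trans (*-identityˡ _) (ΠQ-1 r _ in-range)
  where
  in-range : ∀ i → ind (ρ i <? suc m) ≡ 1ℚ
  in-range i with ρ i <? suc m
  ... | yes _ = refl
  ... | no ρi≰m = ⊥-elim (ρi≰m (s≤s (subst (ρ i ≤_) (trans (sym (sum-tabulate r ρ)) e) (ΣN-≤ r ρ i))))
... | yes e | no ne = ⊥-elim (ne (trans (sym (sum-tabulate r ρ)) e))
... | no ne | yes e = ⊥-elim (ne (trans (sum-tabulate r ρ) e))
... | no _  | no _  = *-zeroˡ (ΠQ r (λ i → ind (ρ i <? suc m)))

restrict : ∀ {n r} → (Fin n → ℚ) → Fin r → Fin n → ℚ
restrict y i l = if toℕ i ≤ᵇ toℕ l then y l else 0ℚ

rowWeight : ∀ {n r} → (Fin n → ℚ) → Fin r → Vec ℕ n → ℚ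
rowWeight {n} y i v = ι (multinomialCoeff v) * ΠQ n (λ l → powℚ (restrict y i l) (lookup v l))

matrixWeight : ∀ {n r} → (Fin n → ℚ) → Mat r n → ℚ
matrixWeight {r = r} y A = ΠQ r (λ i → rowWeight y i (lookup A i))

exponents : (m n : ℕ) → List (Vec ℕ n)
exponents m n = vecsOver (upTo (suc m)) n

matrices : (r n m : ℕ) → List (Mat r n)
matrices r n m = vecsOver (exponents m n) r

powers-as-matrix-sum : ∀ n r m (y : Fin n → ℚ) (c : Vec ℕ r) →
  ind (Vec.sum c ≟ m) * ΠQ r (λ i → powℚ (s n y (toℕ i)) (lookup c i))
    ≡ ind (Vec.sum c ≟ m) * sumℚ (map (λ A → ΠQ r (λ i → multinomialTerm (lookup c i) (restrict y i) (lookup A i)))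
                                        (matrices r n m))
powers-as-matrix-sum n r m y c = under-indicator (Vec.sum c ≟ m) λ Σc≡m → begin
  ΠQ r (λ i → powℚ (ΣQ n (restrict y i)) (lookup c i))
    ≡⟨ ΠQ-cong r (λ i → multinomial m n (lookup c i) (subst (lookup c i ≤_) Σc≡m (lookup≤sum c i)) (restrict y i)) ⟩
  ΠQ r (λ i → sumℚ (map (multinomialTerm (lookup c i) (restrict y i)) (exponents m n)))
    ≡⟨ ΠQ-of-sums (exponents m n) r (λ i → multinomialTerm (lookup c i) (restrict y i)) ⟩
  sumℚ (map (λ A → ΠQ r (λ i → multinomialTerm (lookup c i) (restrict y i) (lookup A i))) (matrices r n m)) ∎

-- Conversely, a matrix A arises from exactly one composition c, namely its
-- vector of row sums, and it does so iff its entries sum to m.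
sum-over-compositions : ∀ n r m (y : Fin n → ℚ) (A : Mat r n) →
  sumℚ (map (λ c → ind (Vec.sum c ≟ m) * ΠQ r (λ i → multinomialTerm (lookup c i) (restrict y i) (lookup A i)))
            (exponents m r))
    ≡ ind (entrySum A ≟ m) * matrixWeight y A
sum-over-compositions n r m y A = begin
  sumℚ (map (λ c → ind (Vec.sum c ≟ m) * ΠQ r (λ i → ind (ρ i ≟ lookup c i) * w i)) (exponents m r))
    ≡⟨ sum-cong (λ c → trans (cong (ind (Vec.sum c ≟ m) *_) (ΠQ-* r (λ i → ind (ρ i ≟ lookup c i)) w))
                             (sym (*-assoc (ind (Vec.sum c ≟ m)) _ _))) (exponents m r) ⟩
  sumℚ (map (λ c → ind (Vec.sum c ≟ m) * ΠQ r (λ i → ind (ρ i ≟ lookup c i)) * matrixWeight y A) (exponents m r))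
    ≡⟨ sym (sum-distribʳ (matrixWeight y A) _ (exponents m r)) ⟩
  sumℚ (map (λ c → ind (Vec.sum c ≟ m) * ΠQ r (λ i → ind (ρ i ≟ lookup c i))) (exponents m r)) * matrixWeight y A
    ≡⟨ cong (_* matrixWeight y A) (sum-deltas (suc m) r (λ c → ind (Vec.sum c ≟ m)) ρ) ⟩
  ind (Vec.sum (Vec.tabulate ρ) ≟ m) * ΠQ r (λ i → ind (ρ i <? suc m)) * matrixWeight y A
    ≡⟨ cong (_* matrixWeight y A) (sum-condition r m ρ) ⟩
  ind (entrySum A ≟ m) * matrixWeight y A ∎
  where
  ρ : Fin r → ℕ
  ρ i = total (lookup A i)
  w : Fin r → ℚ
  w i = rowWeight y i (lookup A i)

H-as-matrix-sum : ∀ n r m (y : Fin n → ℚ) →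
  H r m (λ i → s n y (toℕ i)) ≡ sumℚ (map (λ A → ind (entrySum A ≟ m) * matrixWeight y A) (matrices r n m))
H-as-matrix-sum n r m y = begin
  sumℚ (map (λ c → ΠQ r (S c)) (filter (λ c → Vec.sum c ≟ m) Cs))
    ≡⟨ sum-filter (λ c → Vec.sum c ≟ m) _ Cs ⟩
  sumℚ (map (λ c → ind (Vec.sum c ≟ m) * ΠQ r (S c)) Cs)
    ≡⟨ sum-cong (powers-as-matrix-sum n r m y) Cs ⟩
  sumℚ (map (λ c → ind (Vec.sum c ≟ m) * sumℚ (map (term c) Ms)) Cs)
    ≡⟨ sum-cong (λ c → sum-distribˡ (ind (Vec.sum c ≟ m)) (term c) Ms) Cs ⟩
  sumℚ (map (λ c → sumℚ (map (λ A → ind (Vec.sum c ≟ m) * term c A) Ms)) Cs)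
    ≡⟨ sum-swap (λ c A → ind (Vec.sum c ≟ m) * term c A) Cs Ms ⟩
  sumℚ (map (λ A → sumℚ (map (λ c → ind (Vec.sum c ≟ m) * term c A) Cs)) Ms)
    ≡⟨ sum-cong (sum-over-compositions n r m y) Ms ⟩
  sumℚ (map (λ A → ind (entrySum A ≟ m) * matrixWeight y A) Ms) ∎
  where
  Cs = exponents m r
  Ms = matrices r n m
  S : Vec ℕ r → Fin r → ℚ
  S c i = powℚ (s n y (toℕ i)) (lookup c i)
  term : Vec ℕ r → Mat r n → ℚ
  term c A = ΠQ r (λ i → multinomialTerm (lookup c i) (restrict y i) (lookup A i))

neg-square : ∀ a b → - a * (- a * b) ≡ a * (a * b)
neg-square = solve-∀ ℚ-almostRing

NegatedPower : ℚ → ℕ → Set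
NegatedPower x c = (2 ∣ c × powℚ (- x) c ≡ powℚ x c) ⊎ (¬ 2 ∣ c × powℚ (- x) c ≡ - powℚ x c)

pow-neg : ∀ x c → NegatedPower x c
pow-neg x zero          = inj₁ (2 ∣0 , refl)
pow-neg x (suc zero)    = inj₂ ((λ 2∣1 → contradiction (∣1⇒≡1 2∣1) λ ()) , sym (neg-distribˡ-* x 1ℚ))
pow-neg x (suc (suc c)) with pow-neg x c
... | inj₁ (2∣c , even) =
  inj₁ (∣m∣n⇒∣m+n (n∣n {2}) 2∣c , trans (neg-square x (powℚ (- x) c)) (cong (λ t → x * (x * t)) even))
... | inj₂ (2∤c , odd) =
  inj₂ ((λ 2∣2+c → 2∤c (∣m+n∣m⇒∣n 2∣2+c (n∣n {2}))) ,
        trans (neg-square x (powℚ (- x) c)) (trans (cong (λ t → x * (x * t)) odd) (pull-neg x (powℚ x c))))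
  where
  pull-neg : ∀ a b → a * (a * (- b)) ≡ - (a * (a * b))
  pull-neg = solve-∀ ℚ-almostRing

sign-average : ∀ x c →
  ½ * sumℚ (map (λ e → powℚ (e * x) c) (1ℚ ∷ (- 1ℚ) ∷ [])) ≡ ind (2 ∣? c) * powℚ x c
sign-average x c = begin
  ½ * (powℚ (1ℚ * x) c + (powℚ (- 1ℚ * x) c + 0ℚ))
    ≡⟨ cong₂ (λ a b → ½ * (powℚ a c + b)) (*-identityˡ x) (trans (+-identityʳ _) (cong (λ t → powℚ t c) minus-one-times)) ⟩
  ½ * (powℚ x c + powℚ (- x) c)  ≡⟨ by-parity (pow-neg x c) (2 ∣? c) ⟩
  ind (2 ∣? c) * powℚ x c        ∎
  where
  minus-one-times : - 1ℚ * x ≡ - x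
  minus-one-times = trans (sym (neg-distribˡ-* 1ℚ x)) (cong -_ (*-identityˡ x))
  by-parity : NegatedPower x c → (d : Dec (2 ∣ c)) → ½ * (powℚ x c + powℚ (- x) c) ≡ ind d * powℚ x c
  by-parity (inj₁ (_ , even)) (yes _) = begin
    ½ * (powℚ x c + powℚ (- x) c) ≡⟨ cong (λ t → ½ * (powℚ x c + t)) even ⟩
    ½ * (powℚ x c + powℚ x c)     ≡⟨ half-double (powℚ x c) ⟩
    1ℚ * powℚ x c                  ∎
    where
    half-double : ∀ a → ½ * (a + a) ≡ 1ℚ * a
    half-double = solve-∀ ℚ-almostRing
  by-parity (inj₁ (2∣c , _)) (no 2∤c) = contradiction 2∣c 2∤c
  by-parity (inj₂ (2∤c , _)) (yes 2∣c) = contradiction 2∣c 2∤c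
  by-parity (inj₂ (_ , odd)) (no _) = begin
    ½ * (powℚ x c + powℚ (- x) c)   ≡⟨ cong (λ t → ½ * (powℚ x c + t)) odd ⟩
    ½ * (powℚ x c + - powℚ x c)     ≡⟨ cong (½ *_) (+-inverseʳ (powℚ x c)) ⟩
    ½ * 0ℚ                           ≡⟨ *-zeroʳ ½ ⟩
    0ℚ                               ≡⟨ sym (*-zeroˡ (powℚ x c)) ⟩
    0ℚ * powℚ x c                    ∎

-- 2^{-n} Σ_ε Π_l (ε_l x_l)^{c_l} = Π_l [2 ∣ c_l] x_l^{c_l}: the average factorises over l.
monomial-sign-average : ∀ n (x : Fin n → ℚ) (c : Fin n → ℕ) →
  powℚ ½ n * sumℚ (map (λ ε → ΠQ n (λ l → powℚ (lookup ε l * x l) (c l))) (signs n))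
    ≡ ΠQ n (λ l → ind (2 ∣? c l) * powℚ (x l) (c l))
monomial-sign-average n x c = begin
  powℚ ½ n * sumℚ (map (λ ε → ΠQ n (λ l → F l (lookup ε l))) (signs n))
    ≡⟨ cong₂ _*_ (pow-as-ΠQ ½ n) (sym (ΠQ-of-sums (1ℚ ∷ (- 1ℚ) ∷ []) n F)) ⟩
  ΠQ n (λ _ → ½) * ΠQ n (λ l → sumℚ (map (F l) (1ℚ ∷ (- 1ℚ) ∷ [])))
    ≡⟨ sym (ΠQ-* n (λ _ → ½) _) ⟩
  ΠQ n (λ l → ½ * sumℚ (map (F l) (1ℚ ∷ (- 1ℚ) ∷ [])))
    ≡⟨ ΠQ-cong n (λ l → sign-average (x l) (c l)) ⟩
  ΠQ n (λ l → ind (2 ∣? c l) * powℚ (x l) (c l)) ∎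
  where
  F : Fin n → ℚ → ℚ
  F l e = powℚ (e * x l) (c l)

-- (z_{il})^a = [l < i ⇒ a = 0] · y_l^a: the restriction to l ≥ i becomes
-- the upper-quadrilateral condition on the exponent.
restricted-power : ∀ {n r} (y : Fin n → ℚ) (i : Fin r) (l : Fin n) a →
  powℚ (restrict y i l) a ≡ ind ((toℕ l <? toℕ i) →-dec (a ≟ 0)) * powℚ (y l) a
restricted-power y i l a with toℕ i ≤ᵇ toℕ l in i≤ᵇl
... | true with toℕ l <? toℕ i
...   | yes l<i = ⊥-elim (NP.<⇒≱ l<i (NP.≤ᵇ⇒≤ (toℕ i) (toℕ l) (subst T (sym i≤ᵇl) tt)))
...   | no _    = sym (*-identityˡ _)
restricted-power y i l a | false with toℕ l <? toℕ i
...   | no l≮i = ⊥-elim (l≮i (NP.≰⇒> (λ i≤l → subst T i≤ᵇl (NP.≤⇒≤ᵇ i≤l))))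
...   | yes _ with a
...     | zero   = refl
...     | suc a′ = trans (*-zeroˡ (powℚ 0ℚ a′)) (sym (*-zeroˡ (y l * powℚ (y l) a′)))

upperIndicator : ∀ {r n} → Mat r n → ℚ
upperIndicator {r} {n} A = ΠQ r (λ i → ΠQ n (λ l → ind ((toℕ l <? toℕ i) →-dec (entry A i l ≟ 0))))

rowCoefficients : ∀ {r n} → Mat r n → ℚ
rowCoefficients {r} A = ΠQ r (λ i → ι (multinomialCoeff (lookup A i)))

matrixWeight-split : ∀ {r n} (y : Fin n → ℚ) (A : Mat r n) →
  matrixWeight y A ≡ rowCoefficients A * (upperIndicator A * ΠQ n (λ l → powℚ (y l) (colSum A l)))
matrixWeight-split {r} {n} y A = begin
  ΠQ r (λ i → ι (multinomialCoeff (lookup A i)) * Z i)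
    ≡⟨ ΠQ-* r (λ i → ι (multinomialCoeff (lookup A i))) Z ⟩
  rowCoefficients A * ΠQ r Z
    ≡⟨ cong (rowCoefficients A *_) (ΠQ-cong r split-row) ⟩
  rowCoefficients A * ΠQ r (λ i → ΠQ n (U i) * ΠQ n (λ l → powℚ (y l) (entry A i l)))
    ≡⟨ cong (rowCoefficients A *_) (ΠQ-* r (λ i → ΠQ n (U i)) (λ i → ΠQ n (λ l → powℚ (y l) (entry A i l)))) ⟩
  rowCoefficients A * (upperIndicator A * ΠQ r (λ i → ΠQ n (λ l → powℚ (y l) (entry A i l))))
    ≡⟨ cong (λ t → rowCoefficients A * (upperIndicator A * t)) (ΠQ-swap r n (λ i l → powℚ (y l) (entry A i l))) ⟩
  rowCoefficients A * (upperIndicator A * ΠQ n (λ l → ΠQ r (λ i → powℚ (y l) (entry A i l))))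
    ≡⟨ cong (λ t → rowCoefficients A * (upperIndicator A * t)) (ΠQ-cong n (λ l → ΠQ-pow r (y l) (λ i → entry A i l))) ⟩
  rowCoefficients A * (upperIndicator A * ΠQ n (λ l → powℚ (y l) (colSum A l))) ∎
  where
  Z : Fin r → ℚ
  Z i = ΠQ n (λ l → powℚ (restrict y i l) (entry A i l))
  U : Fin r → Fin n → ℚ
  U i l = ind ((toℕ l <? toℕ i) →-dec (entry A i l ≟ 0))
  split-row : ∀ i → Z i ≡ ΠQ n (U i) * ΠQ n (λ l → powℚ (y l) (entry A i l))
  split-row i = trans (ΠQ-cong n (λ l → restricted-power y i l (entry A i l)))
                      (ΠQ-* n (U i) (λ l → powℚ (y l) (entry A i l)))

admissible-indicator : ∀ {r n} m (A : Mat r n) →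
  ind (admissible? m A) ≡ upperIndicator A * (ind (entrySum A ≟ m) * ΠQ n (λ l → ind (2 ∣? colSum A l)))
admissible-indicator {r} {n} m A = begin
  ind (upper? ×-dec (entrySum A ≟ m) ×-dec all? (λ l → 2 ∣? colSum A l))
    ≡⟨ ind-× upper? _ ⟩
  ind upper? * ind ((entrySum A ≟ m) ×-dec all? (λ l → 2 ∣? colSum A l))
    ≡⟨ cong₂ _*_ (trans (ind-all r _) (ΠQ-cong r (λ i → ind-all n _)))
                 (trans (ind-× (entrySum A ≟ m) _) (cong (ind (entrySum A ≟ m) *_) (ind-all n _))) ⟩
  upperIndicator A * (ind (entrySum A ≟ m) * ΠQ n (λ l → ind (2 ∣? colSum A l))) ∎
  where
  upper? = all? (λ i → all? (λ j → (toℕ j <? toℕ i) →-dec (entry A i j ≟ 0)))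

matrix-sign-average : ∀ {r n} m (x : Fin n → ℚ) (A : Mat r n) →
  powℚ ½ n * sumℚ (map (λ ε → ind (entrySum A ≟ m) * matrixWeight (λ l → lookup ε l * x l) A) (signs n))
    ≡ ind (admissible? m A) * (coeff A * monoEA x A)
matrix-sign-average {r} {n} m x A = begin
  powℚ ½ n * sumℚ (map (λ ε → I * matrixWeight (λ l → lookup ε l * x l) A) (signs n))
    ≡⟨ cong (powℚ ½ n *_) (sum-cong (λ ε → trans (cong (I *_) (matrixWeight-split _ A)) (regroup I K U (P ε))) (signs n)) ⟩
  powℚ ½ n * sumℚ (map (λ ε → (I * (K * U)) * P ε) (signs n))
    ≡⟨ cong (powℚ ½ n *_) (sym (sum-distribˡ (I * (K * U)) P (signs n))) ⟩
  powℚ ½ n * ((I * (K * U)) * sumℚ (map P (signs n)))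
    ≡⟨ swap-front (powℚ ½ n) (I * (K * U)) _ ⟩
  (I * (K * U)) * (powℚ ½ n * sumℚ (map P (signs n)))
    ≡⟨ cong ((I * (K * U)) *_) (monomial-sign-average n x (colSum A)) ⟩
  (I * (K * U)) * ΠQ n (λ l → ind (2 ∣? colSum A l) * powℚ (x l) (colSum A l))
    ≡⟨ cong ((I * (K * U)) *_) (ΠQ-* n (λ l → ind (2 ∣? colSum A l)) (λ l → powℚ (x l) (colSum A l))) ⟩
  (I * (K * U)) * (E * monoEA x A)
    ≡⟨ separate I K U E (monoEA x A) ⟩
  (U * (I * E)) * (K * monoEA x A)
    ≡⟨ sym (cong₂ _*_ (admissible-indicator m A) (cong (_* monoEA x A) (coeff-as-rowMultinomials A))) ⟩
  ind (admissible? m A) * (coeff A * monoEA x A) ∎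
  where
  I = ind (entrySum A ≟ m)
  K = rowCoefficients A
  U = upperIndicator A
  E = ΠQ n (λ l → ind (2 ∣? colSum A l))
  P : Vec ℚ n → ℚ
  P ε = ΠQ n (λ l → powℚ (lookup ε l * x l) (colSum A l))
  regroup : ∀ i c u p → i * (c * (u * p)) ≡ (i * (c * u)) * p
  regroup = solve-∀ ℚ-almostRing
  swap-front : ∀ h k t → h * (k * t) ≡ k * (h * t)
  swap-front = solve-∀ ℚ-almostRing
  separate : ∀ i c u e p → (i * (c * u)) * (e * p) ≡ (u * (i * e)) * (c * p)
  separate = solve-∀ ℚ-almostRing

lemma2p2 : (n k m : ℕ) → 1 ≤ n → k ≤ n → 1 ≤ m → (x : Fin n → ℚ) →
    g n k m x ≡ sumℚ (map (λ A → coeff A * monoEA x A) (admissibleMats (suc k) n m))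
lemma2p2 n k m _ _ _ x = begin
  powℚ ½ n * sumℚ (map (λ ε → h n k m (signed ε)) (signs n))
    ≡⟨ cong (powℚ ½ n *_) (sum-cong (λ ε → H-as-matrix-sum n (suc k) m (signed ε)) (signs n)) ⟩
  powℚ ½ n * sumℚ (map (λ ε → sumℚ (map (contribution ε) Ms)) (signs n))
    ≡⟨ cong (powℚ ½ n *_) (sum-swap contribution (signs n) Ms) ⟩
  powℚ ½ n * sumℚ (map (λ A → sumℚ (map (λ ε → contribution ε A) (signs n))) Ms)
    ≡⟨ sum-distribˡ (powℚ ½ n) _ Ms ⟩
  sumℚ (map (λ A → powℚ ½ n * sumℚ (map (λ ε → contribution ε A) (signs n))) Ms)
    ≡⟨ sum-cong (matrix-sign-average m x) Ms ⟩
  sumℚ (map (λ A → ind (admissible? m A) * (coeff A * monoEA x A)) Ms)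
    ≡⟨ sym (sum-filter (admissible? m) (λ A → coeff A * monoEA x A) Ms) ⟩
  sumℚ (map (λ A → coeff A * monoEA x A) (admissibleMats (suc k) n m)) ∎
  where
  signed : Vec ℚ n → Fin n → ℚ
  signed ε l = lookup ε l * x l
  Ms = matrices (suc k) n m
  contribution : Vec ℚ n → Mat (suc k) n → ℚ
  contribution ε A = ind (entrySum A ≟ m) * matrixWeight (signed ε) A
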